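{- Let $p$ be an odd prime. For all integers $v$, $k$ and every integer $r\ge 1$, $$H_{r-1}(v+kp^{r})\equiv H_{r-1}(v)-k\,v^{p-2}\pmod p.$$
   Context: Let $\varphi$ be Euler's totient function. For an integer $r\ge1$, the Euler quotient $Q_r(u)$ is the unique integer with $0\le Q_r(u)<p^r$ and $Q_r(u)\equiv \frac{u^{\varphi(p^r)}-1}{p^r}\pmod{p^r}$ when $\gcd(u,p)=1$; and $Q_r(u)=0$ when $p\mid u$. One has $Q_r(u)\equiv Q_{r-1}(u)\pmod{p^{r-1}}$ for $r\ge2$. Define $H_0(u)=Q_1(u)$ (the Fermat quotient) and, for $r\ge2$, $H_{r-1}(u)$ as the unique integer with $0\le H_{r-1}(u)<p$ and $H_{r-1}(u)\equiv \frac{Q_r(u)-Q_{r-1}(u)}{p^{r-1}}\pmod p$. Equivalently, $H_{r-1}(u)$ is the highest digit $a_{r-1}(u)$ in the $p$-adic expansion $Q_r(u)=a_0(u)+a_1(u)p+\dots+a_{r-1}(u)p^{r-1}$, $0\le a_j(u)<p$. -}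

module Defs where

open import Data.Nat as ℕ using (ℕ; zero; suc; NonZero)
open import Data.Nat.Properties using (m^n≢0)
open import Data.Nat.GCD using (gcd)
open import Data.Nat.Primality using (Prime; prime⇒nonZero)
open import Data.List using (List; length; filter; map; upTo)
open import Data.Integer as ℤ using (ℤ; +_; _-_; _/ℕ_; _%ℕ_)
open import Data.Integer.Divisibility.Signed using (_∣?_)
open import Relation.Nullary using (yes; no)

φ : ℕ → ℕ
φ n = length (filter (λ k → gcd k n ℕ.≟ 1) (map suc (upTo n)))

Q : (p : ℕ) → Prime p → (r : ℕ) → ℤ → ℕ
Q p pp r u with (+ p) ∣? u
... | yes _ = 0
... | no  _ =
  let instance _ = prime⇒nonZero pp
      instance _ = m^n≢0 p r
  in ((u ℤ.^ φ (p ℕ.^ r) - ℤ.1ℤ) /ℕ (p ℕ.^ r)) %ℕ (p ℕ.^ r)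

-- H m u  stands for  H_m(u)  (so H_{r-1} is  H (r - 1)).
-- H_0 = Q_1;  H_{r-1}(u) ≡ (Q_r(u) - Q_{r-1}(u)) / p^{r-1}  (mod p), in [0,p).
H : (p : ℕ) → Prime p → ℕ → ℤ → ℕ
H p pp zero u = Q p pp 1 u
H p pp (suc m) u =
  let instance _ = prime⇒nonZero pp
      instance _ = m^n≢0 p (suc m)
  in ((+ Q p pp (suc (suc m)) u - + Q p pp (suc m) u) /ℕ (p ℕ.^ suc m)) %ℕ p

-- Put d = p^r and N = φ(d) = p^(r-1) (p-1). For a unit v the binomial theorem gives
-- (v + k d)^N ≡ v^N + N k d v^(N-1) (mod d²); dividing by d, the Euler quotient shifts as
-- Q_r(v + k d) ≡ Q_r(v) + N k v^(N-1) (mod d). The same computation one level down shows that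
-- Q_(r-1)(v + k d) = Q_(r-1)(v), so Q_r - Q_(r-1) moves by N k v^(N-1) + (multiple of d), which is
-- p^(r-1) ((p-1) k v^(N-1) + multiple of p). Hence H_(r-1) moves by (p-1) k v^(N-1) ≡ -k v^(p-2)
-- (mod p), the last step by Fermat's little theorem. If p ∣ v, both H-values are 0, and
-- p ∣ v^(p-2) because p is odd.
module Submission where

open import Defs
open import Level using (0ℓ)
open import Data.Nat as ℕ using (ℕ; suc; zero; NonZero; _!; _∸_; z≤n; s≤s)
import Data.Nat.Properties as ℕ
open import Data.Nat.Primality using (Prime; prime⇒nonZero; prime⇒irreducible; euclidsLemma; ¬prime[1])
open import Data.Nat.Divisibility as ℕD using ()
open import Data.Nat.DivMod using (0/n≡0; m<n⇒m%n≡m; %-remove-+ʳ; m/n*n≡m)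
open import Data.Nat.Coprimality as Coprime using (Coprime)
open import Data.Nat.GCD using (gcd; gcd-greatest)
open import Data.Nat.Combinatorics using (_C_; nCn≡1; nCk≡n!/k![n-k]!; k![n∸k]!∣n!)
open import Data.Nat.Tactic.RingSolver using () renaming (solve-∀ to ℕ-solve-∀)
open import Data.Fin using (Fin; zero; suc; toℕ; fromℕ; inject₁)
open import Data.Fin.Properties using (toℕ-fromℕ; toℕ-inject₁; toℕ<n)
open import Data.Vec.Functional using (Vector)
open import Data.List using ([]; _∷_; length; filter; map; upTo; _++_)
import Data.List.Properties as List
open import Data.Integer as ℤ using (ℤ; +_; _+_; _-_; _*_; _^_; -_; 0ℤ; 1ℤ; _/ℕ_; _%ℕ_)
import Data.Integer.Properties as ℤ
open import Data.Integer.DivMod using (a≡a%ℕn+[a/ℕn]*n; n%ℕd<d)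
open import Data.Integer.Divisibility.Signed
import Data.Integer.Coprimality as ℤ
open import Data.Integer.Tactic.RingSolver using (solve-∀)
open import Algebra.Bundles using (CommutativeSemiring)
open import Algebra.Definitions.RawSemiring (CommutativeSemiring.rawSemiring ℤ.+-*-commutativeSemiring)
  using (sum) renaming (_^_ to _^ₛ_; _×_ to _×ₛ_)
open import Algebra.Properties.Monoid.Sum ℤ.+-0-monoid using (sum-init-last)
open import Algebra.Properties.CommutativeSemiring.Binomial ℤ.+-*-commutativeSemiring as Binomial
  using (binomialExpansion; binomialTerm)
open import Data.Product using (_,_)
open import Data.Sum using (inj₁; inj₂)
open import Data.Empty using (⊥-elim)
open import Function using (_∘_)
open import Relation.Unary using (Pred; Decidable)
open import Relation.Nullary using (¬_; yes; no)
open import Relation.Binary.Bundles using (Setoid)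
open import Relation.Binary.Structures using (IsEquivalence)
open import Relation.Binary.PropositionalEquality
import Relation.Binary.Reasoning.Setoid

-- Congruence modulo an integer

-- A record rather than an abbreviation of  m ∣ a - b , so that a, b and m are
-- recovered from the type by unification.
infix 4 _≡_[mod_]
record _≡_[mod_] (a b m : ℤ) : Set where
  constructor ≡-mod
  field
    ∣-difference : m ∣ a - b
open _≡_[mod_] public

module _ {m : ℤ} where

  ≡-mod-refl : ∀ {a} → a ≡ a [mod m ]
  ≡-mod-refl {a} = ≡-mod (subst (m ∣_) (sym (ℤ.+-inverseʳ a)) (divides 0ℤ refl))

  ≡-mod-reflexive : ∀ {a b} → a ≡ b → a ≡ b [mod m ]
  ≡-mod-reflexive refl = ≡-mod-refl

  ≡-mod-sym : ∀ {a b} → a ≡ b [mod m ] → b ≡ a [mod m ]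
  ≡-mod-sym {a} {b} (≡-mod m∣a-b) = ≡-mod (subst (m ∣_) (identity a b) (∣m⇒∣-m m∣a-b))
    where
    identity : ∀ a b → - (a - b) ≡ b - a
    identity = solve-∀

  ≡-mod-trans : ∀ {a b c} → a ≡ b [mod m ] → b ≡ c [mod m ] → a ≡ c [mod m ]
  ≡-mod-trans {a} {b} {c} (≡-mod m∣a-b) (≡-mod m∣b-c) =
    ≡-mod (subst (m ∣_) (identity a b c) (∣m∣n⇒∣m+n m∣a-b m∣b-c))
    where
    identity : ∀ a b c → (a - b) + (b - c) ≡ a - c
    identity = solve-∀

  ≡-mod-isEquivalence : IsEquivalence (λ a b → a ≡ b [mod m ])
  ≡-mod-isEquivalence = record { refl = ≡-mod-refl ; sym = ≡-mod-sym ; trans = ≡-mod-trans }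

  +-cong-mod : ∀ {a b c d} → a ≡ b [mod m ] → c ≡ d [mod m ] → a + c ≡ b + d [mod m ]
  +-cong-mod {a} {b} {c} {d} (≡-mod m∣a-b) (≡-mod m∣c-d) =
    ≡-mod (subst (m ∣_) (identity a b c d) (∣m∣n⇒∣m+n m∣a-b m∣c-d))
    where
    identity : ∀ a b c d → (a - b) + (c - d) ≡ (a + c) - (b + d)
    identity = solve-∀

  *-cong-mod : ∀ {a b c d} → a ≡ b [mod m ] → c ≡ d [mod m ] → a * c ≡ b * d [mod m ]
  *-cong-mod {a} {b} {c} {d} (≡-mod m∣a-b) (≡-mod m∣c-d) =
    ≡-mod (subst (m ∣_) (identity a b c d) (∣m∣n⇒∣m+n (∣n⇒∣m*n c m∣a-b) (∣n⇒∣m*n b m∣c-d)))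
    where
    identity : ∀ a b c d → c * (a - b) + b * (c - d) ≡ a * c - b * d
    identity = solve-∀

  ^-cong-mod : ∀ {a b} n → a ≡ b [mod m ] → a ^ n ≡ b ^ n [mod m ]
  ^-cong-mod zero    a≡b = ≡-mod-refl
  ^-cong-mod (suc n) a≡b = *-cong-mod a≡b (^-cong-mod n a≡b)

  ∣⇒≡0-mod : ∀ {a} → m ∣ a → a ≡ 0ℤ [mod m ]
  ∣⇒≡0-mod {a} m∣a = ≡-mod (subst (m ∣_) (sym (ℤ.+-identityʳ a)) m∣a)

  +-multiple-mod : ∀ a y → a + y * m ≡ a [mod m ]
  +-multiple-mod a y = ≡-mod (divides y (identity a y m))
    where
    identity : ∀ a y m → a + y * m - a ≡ y * m
    identity = solve-∀

≡-mod-weaken : ∀ {m n a b} → n ∣ m → a ≡ b [mod m ] → a ≡ b [mod n ]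
≡-mod-weaken n∣m (≡-mod m∣a-b) = ≡-mod (∣-trans n∣m m∣a-b)

≡-mod-setoid : ℤ → Setoid 0ℓ 0ℓ
≡-mod-setoid m = record { isEquivalence = ≡-mod-isEquivalence {m} }

module ≡-mod-Reasoning (m : ℤ) = Relation.Binary.Reasoning.Setoid (≡-mod-setoid m)

-- Division with remainder by a natural number

m-n≡o⇒m≡n+o : ∀ {m n o} → m - n ≡ o → m ≡ n + o
m-n≡o⇒m≡n+o {m} {n} refl = identity m n
  where
  identity : ∀ m n → m ≡ n + (m - n)
  identity = solve-∀

module _ {d : ℕ} .{{_ : NonZero d}} where

  private
    residue-unique-≤ : ∀ {r s} → r ℕ.≤ s → r ℕ.< d → s ℕ.< d → + s ≡ + r [mod + d ] → s ≡ r
    residue-unique-≤ {r} {s} r≤s r<d s<d (≡-mod d∣s-r) = begin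
      s                        ≡⟨ m<n⇒m%n≡m s<d ⟨
      s ℕ.% d                  ≡⟨ cong (ℕ._% d) (ℕ.m+[n∸m]≡n r≤s) ⟨
      (r ℕ.+ (s ∸ r)) ℕ.% d    ≡⟨ %-remove-+ʳ r d∣s∸r ⟩
      r ℕ.% d                  ≡⟨ m<n⇒m%n≡m r<d ⟩
      r                        ∎
      where
      open ≡-Reasoning
      d∣s∸r = ∣⇒∣ᵤ (subst (+ d ∣_) (trans (ℤ.m-n≡m⊖n s r) (ℤ.⊖-≥ r≤s)) d∣s-r)

  residue-unique : ∀ {r s} → r ℕ.< d → s ℕ.< d → + r ≡ + s [mod + d ] → r ≡ s
  residue-unique {r} {s} r<d s<d r≡s with ℕ.≤-total r s
  ... | inj₁ r≤s = sym (residue-unique-≤ r≤s r<d s<d (≡-mod-sym r≡s))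
  ... | inj₂ s≤r = residue-unique-≤ s≤r s<d r<d r≡s

  %ℕ-mod : ∀ a → + (a %ℕ d) ≡ a [mod + d ]
  %ℕ-mod a = ≡-mod-sym (subst (_≡ + (a %ℕ d) [mod + d ]) (sym (a≡a%ℕn+[a/ℕn]*n a d))
                              (+-multiple-mod (+ (a %ℕ d)) (a /ℕ d)))

  %ℕ-+-multiple : ∀ a y → (a + y * + d) %ℕ d ≡ a %ℕ d
  %ℕ-+-multiple a y = residue-unique (n%ℕd<d (a + y * + d) d) (n%ℕd<d a d) (begin
    + ((a + y * + d) %ℕ d)  ≈⟨ %ℕ-mod _ ⟩
    a + y * + d             ≈⟨ +-multiple-mod a y ⟩
    a                       ≈⟨ %ℕ-mod a ⟨
    + (a %ℕ d)              ∎)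
    where open ≡-mod-Reasoning (+ d)

  [a/ℕd]*d≡a-a%ℕd : ∀ a → a /ℕ d * + d ≡ a - + (a %ℕ d)
  [a/ℕd]*d≡a-a%ℕd a =
    trans (identity (+ (a %ℕ d)) (a /ℕ d * + d)) (cong (_- + (a %ℕ d)) (sym (a≡a%ℕn+[a/ℕn]*n a d)))
    where
    identity : ∀ r x → x ≡ r + x - r
    identity = solve-∀

  /ℕ-+-multiple : ∀ a y → (a + y * + d) /ℕ d ≡ a /ℕ d + y
  /ℕ-+-multiple a y = ℤ.*-cancelʳ-≡ _ _ (+ d) (begin
    (a + y * + d) /ℕ d * + d              ≡⟨ [a/ℕd]*d≡a-a%ℕd (a + y * + d) ⟩
    a + y * + d - + ((a + y * + d) %ℕ d)  ≡⟨ cong (λ r → a + y * + d - + r) (%ℕ-+-multiple a y) ⟩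
    a + y * + d - + (a %ℕ d)              ≡⟨ identity a (+ (a %ℕ d)) y (+ d) ⟩
    (a - + (a %ℕ d)) + y * + d            ≡⟨ cong (_+ y * + d) ([a/ℕd]*d≡a-a%ℕd a) ⟨
    a /ℕ d * + d + y * + d                ≡⟨ ℤ.*-distribʳ-+ (+ d) (a /ℕ d) y ⟨
    (a /ℕ d + y) * + d                    ∎)
    where
    open ≡-Reasoning
    identity : ∀ a r y d → a + y * d - r ≡ (a - r) + y * d
    identity = solve-∀

  /ℕ-cong-mod : ∀ {a b y m} → a ≡ b + y * + d [mod + d * m ] → a /ℕ d ≡ b /ℕ d + y [mod m ]
  /ℕ-cong-mod {a} {b} {y} {m} (≡-mod (divides z a-[b+yd]≡zdm)) = begin
    a /ℕ d                        ≡⟨ cong (_/ℕ d) a≡b+[y+zm]d ⟩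
    (b + (y + z * m) * + d) /ℕ d  ≡⟨ /ℕ-+-multiple b (y + z * m) ⟩
    b /ℕ d + (y + z * m)          ≡⟨ ℤ.+-assoc (b /ℕ d) y (z * m) ⟨
    b /ℕ d + y + z * m            ≈⟨ +-multiple-mod (b /ℕ d + y) z ⟩
    b /ℕ d + y                    ∎
    where
    open ≡-mod-Reasoning m
    identity : ∀ b y z d m → b + y * d + z * (d * m) ≡ b + (y + z * m) * d
    identity = solve-∀
    a≡b+[y+zm]d : a ≡ b + (y + z * m) * + d
    a≡b+[y+zm]d = trans (m-n≡o⇒m≡n+o a-[b+yd]≡zdm) (identity b y z (+ d) m)

-- The binomial theorem and Fermat's little theorem

first-order-binomial : ∀ v x n → (v + x) ^ suc n ≡ v ^ suc n + + suc n * x * v ^ n [mod x * x ]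
first-order-binomial v x zero    = ≡-mod-reflexive (identity v x)
  where
  identity : ∀ v x → (v + x) * 1ℤ ≡ v * 1ℤ + 1ℤ * x * 1ℤ
  identity = solve-∀
first-order-binomial v x (suc n) = begin
  (v + x) * (v + x) ^ suc n                 ≈⟨ *-cong-mod (≡-mod-refl {a = v + x}) (first-order-binomial v x n) ⟩
  (v + x) * (v ^ suc n + N * x * v ^ n)     ≡⟨ identity v x (v ^ n) N ⟩
  v ^ suc (suc n) + (1ℤ + N) * x * v ^ suc n + N * v ^ n * (x * x) ≈⟨ +-multiple-mod _ (N * v ^ n) ⟩
  v ^ suc (suc n) + (1ℤ + N) * x * v ^ suc n ∎
  where
  open ≡-mod-Reasoning (x * x)
  N = + suc n
  identity : ∀ v x V N → (v + x) * (v * V + N * x * V)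
                         ≡ v * (v * V) + (1ℤ + N) * x * (v * V) + N * V * (x * x)
  identity = solve-∀

prime∤! : ∀ {p m} → Prime p → m ℕ.< p → ¬ p ℕD.∣ m !
prime∤! {m = zero}  pp _   p∣1 = ¬prime[1] (subst Prime (ℕD.∣1⇒≡1 p∣1) pp)
prime∤! {m = suc m} pp m<p p∣m! with euclidsLemma (suc m) (m !) pp p∣m!
... | inj₁ p∣1+m = ℕ.<⇒≱ m<p (ℕD.∣⇒≤ p∣1+m)
... | inj₂ p∣m!  = prime∤! pp (ℕ.<-trans (ℕ.n<1+n m) m<p) p∣m!

n!≡nCk*[k!*[n∸k]!] : ∀ {n k} → k ℕ.≤ n → n ! ≡ (n C k) ℕ.* (k ! ℕ.* (n ∸ k) !)
n!≡nCk*[k!*[n∸k]!] {n} {k} k≤n = sym (begin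
  (n C k) ℕ.* (k ! ℕ.* (n ∸ k) !)                    ≡⟨ cong (ℕ._* (k ! ℕ.* (n ∸ k) !)) (nCk≡n!/k![n-k]! k≤n) ⟩
  n ! ℕ./ (k ! ℕ.* (n ∸ k) !) ℕ.* (k ! ℕ.* (n ∸ k) !) ≡⟨ m/n*n≡m (k![n∸k]!∣n! k≤n) ⟩
  n !                                                ∎)
  where
  open ≡-Reasoning
  instance _ = ℕ._!*_!≢0 k (n ∸ k)

prime∣C : ∀ {p k} → Prime p → 0 ℕ.< k → k ℕ.< p → p ℕD.∣ p C k
prime∣C {p@(suc p-1)} {k} pp 0<k k<p
  with euclidsLemma (p C k) (k ! ℕ.* (p ∸ k) !) pp
         (subst (p ℕD.∣_) (n!≡nCk*[k!*[n∸k]!] (ℕ.<⇒≤ k<p)) (ℕD.m∣m*n (p-1 !)))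
... | inj₁ p∣pCk = p∣pCk
... | inj₂ p∣k!*[p∸k]! with euclidsLemma (k !) ((p ∸ k) !) pp p∣k!*[p∸k]!
...   | inj₁ p∣k!     = ⊥-elim (prime∤! pp k<p p∣k!)
...   | inj₂ p∣[p∸k]! = ⊥-elim (prime∤! pp (ℕ.∸-monoʳ-< 0<k (ℕ.<⇒≤ k<p)) p∣[p∸k]!)

^ₛ≡^ : ∀ x n → x ^ₛ n ≡ x ^ n
^ₛ≡^ x zero    = refl
^ₛ≡^ x (suc n) = cong (x *_) (^ₛ≡^ x n)

×ₛ≡* : ∀ n x → n ×ₛ x ≡ + n * x
×ₛ≡* zero    x = refl
×ₛ≡* (suc n) x = trans (cong (_+_ x) (×ₛ≡* n x)) (sym (ℤ.suc-* (+ n) x))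

binomialTerm≡ : ∀ a b n (k : Fin (suc n)) →
                binomialTerm a b n k ≡ + (n C toℕ k) * (a ^ toℕ k * b ^ (n ∸ toℕ k))
binomialTerm≡ a b n k =
  trans (×ₛ≡* (n C toℕ k) _) (cong (_*_ (+ (n C toℕ k))) (cong₂ _*_ (^ₛ≡^ a (toℕ k)) (^ₛ≡^ b (n ∸ toℕ k))))

binomialTerm-zero : ∀ a b n → binomialTerm a b n zero ≡ b ^ n
binomialTerm-zero a b n = trans (binomialTerm≡ a b n zero) (trans (ℤ.*-identityˡ _) (ℤ.*-identityˡ (b ^ n)))

binomialTerm-last : ∀ a b n → binomialTerm a b n (fromℕ n) ≡ a ^ n
binomialTerm-last a b n = begin
  binomialTerm a b n (fromℕ n)         ≡⟨ binomialTerm≡ a b n (fromℕ n) ⟩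
  + (n C toℕ (fromℕ n)) * (a ^ toℕ (fromℕ n) * b ^ (n ∸ toℕ (fromℕ n)))
    ≡⟨ cong (λ k → + (n C k) * (a ^ k * b ^ (n ∸ k))) (toℕ-fromℕ n) ⟩
  + (n C n) * (a ^ n * b ^ (n ∸ n))    ≡⟨ cong₂ (λ c e → + c * (a ^ n * b ^ e)) (nCn≡1 n) (ℕ.n∸n≡0 n) ⟩
  1ℤ * (a ^ n * 1ℤ)                    ≡⟨ trans (ℤ.*-identityˡ _) (ℤ.*-identityʳ (a ^ n)) ⟩
  a ^ n                                ∎
  where open ≡-Reasoning

sum-∣ : ∀ {m n} (t : Vector ℤ n) → (∀ i → m ∣ t i) → m ∣ sum t
sum-∣ {n = zero}  t m∣t = divides 0ℤ refl
sum-∣ {n = suc n} t m∣t = ∣m∣n⇒∣m+n (m∣t zero) (sum-∣ (t ∘ suc) (m∣t ∘ suc))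

sum≡first+last-mod : ∀ {m n} (t : Vector ℤ (suc (suc n))) → (∀ i → m ∣ t (suc (inject₁ i))) →
                     sum t ≡ t zero + t (fromℕ (suc n)) [mod m ]
sum≡first+last-mod {m} t m∣inner = begin
  t zero + sum (t ∘ suc)                                ≡⟨ cong (_+_ (t zero)) (sum-init-last (t ∘ suc)) ⟩
  t zero + (sum (λ i → t (suc (inject₁ i))) + t last)   ≈⟨ +-cong-mod (≡-mod-refl {a = t zero})
                                                             (+-cong-mod (∣⇒≡0-mod (sum-∣ _ m∣inner)) (≡-mod-refl {a = t last})) ⟩
  t zero + (0ℤ + t last)                                ≡⟨ cong (_+_ (t zero)) (ℤ.+-identityˡ (t last)) ⟩
  t zero + t last                                       ∎
  where
  open ≡-mod-Reasoning m
  last = fromℕ _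

[1+a]^p≡a^p+1 : ∀ {p} → Prime p → ∀ a → (1ℤ + a) ^ p ≡ a ^ p + 1ℤ [mod + p ]
[1+a]^p≡a^p+1 {p@(suc n)} pp a = begin
  (1ℤ + a) ^ p                ≡⟨ ^ₛ≡^ (1ℤ + a) p ⟨
  (1ℤ + a) ^ₛ p               ≡⟨ Binomial.theorem p 1ℤ a ⟩
  binomialExpansion 1ℤ a p    ≈⟨ sum≡first+last-mod t p∣inner ⟩
  t zero + t (fromℕ p)        ≡⟨ cong₂ _+_ (binomialTerm-zero 1ℤ a p) (trans (binomialTerm-last 1ℤ a p) (ℤ.^-zeroˡ p)) ⟩
  a ^ p + 1ℤ                  ∎
  where
  open ≡-mod-Reasoning (+ p)
  t = binomialTerm 1ℤ a p
  p∣inner : ∀ i → + p ∣ t (suc (inject₁ i))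
  p∣inner i = subst (+ p ∣_) (sym (binomialTerm≡ 1ℤ a p (suc (inject₁ i))))
    (∣m⇒∣m*n {m = + (p C suc (toℕ (inject₁ i)))} _
      (∣ᵤ⇒∣ (prime∣C pp (s≤s z≤n) (s≤s (subst (ℕ._< n) (sym (toℕ-inject₁ i)) (toℕ<n i))))))

fermat-ℕ : ∀ {p} → Prime p → ∀ n → (+ n) ^ p ≡ + n [mod + p ]
fermat-ℕ {suc n} pp zero    = ≡-mod-reflexive (ℤ.*-zeroˡ (0ℤ ^ n))
fermat-ℕ {p}     pp (suc n) = begin
  (1ℤ + + n) ^ p   ≈⟨ [1+a]^p≡a^p+1 pp (+ n) ⟩
  (+ n) ^ p + 1ℤ   ≈⟨ +-cong-mod (fermat-ℕ pp n) (≡-mod-refl {a = 1ℤ}) ⟩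
  + n + 1ℤ         ≡⟨ ℤ.+-comm (+ n) 1ℤ ⟩
  1ℤ + + n         ∎
  where open ≡-mod-Reasoning (+ p)

prime∤⇒coprime : ∀ {p k} → Prime p → ¬ p ℕD.∣ k → Coprime p k
prime∤⇒coprime pp p∤k (d∣p , d∣k) with prime⇒irreducible pp d∣p
... | inj₁ d≡1 = d≡1
... | inj₂ refl = ⊥-elim (p∤k d∣k)

module _ {p} (pp : Prime p) where

  private instance _ = prime⇒nonZero pp

  fermat : ∀ a → a ^ p ≡ a [mod + p ]
  fermat a = begin
    a ^ p              ≈⟨ ^-cong-mod p (≡-mod-sym (%ℕ-mod a)) ⟩
    (+ (a %ℕ p)) ^ p   ≈⟨ fermat-ℕ pp (a %ℕ p) ⟩
    + (a %ℕ p)         ≈⟨ %ℕ-mod a ⟩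
    a                  ∎
    where open ≡-mod-Reasoning (+ p)

  *-cancelˡ-mod : ∀ {a b c} → ¬ + p ∣ a → a * b ≡ a * c [mod + p ] → b ≡ c [mod + p ]
  *-cancelˡ-mod {a} {b} {c} p∤a (≡-mod p∣ab-ac) = ≡-mod (∣ᵤ⇒∣ (ℤ.coprime-divisor (+ p) a (b - c)
    (prime∤⇒coprime pp (λ p∣a → p∤a (∣ᵤ⇒∣ p∣a)))
    (∣⇒∣ᵤ (subst (+ p ∣_) (identity a b c) p∣ab-ac))))
    where
    identity : ∀ a b c → a * b - a * c ≡ a * (b - c)
    identity = solve-∀

fermat-unit : ∀ {p a} → Prime p → ¬ + p ∣ a → a ^ (p ∸ 1) ≡ 1ℤ [mod + p ]
fermat-unit {suc n} {a} pp p∤a =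
  *-cancelˡ-mod pp p∤a (≡-mod-trans (fermat pp a) (≡-mod-reflexive (sym (ℤ.*-identityʳ a))))

^[m*[p∸1]∸1]≡^[p∸2] : ∀ {p a} → Prime p → ¬ + p ∣ a →
                      ∀ m .{{_ : NonZero m}} → a ^ (m ℕ.* (p ∸ 1) ∸ 1) ≡ a ^ (p ∸ 2) [mod + p ]
^[m*[p∸1]∸1]≡^[p∸2] {p@(suc (suc t))} {a} pp p∤a (suc m) = begin
  a ^ (t ℕ.+ m ℕ.* suc t)       ≡⟨ ℤ.^-distribˡ-+-* a t (m ℕ.* suc t) ⟩
  a ^ t * a ^ (m ℕ.* suc t)     ≡⟨ cong (λ e → a ^ t * a ^ e) (ℕ.*-comm m (suc t)) ⟩
  a ^ t * a ^ (suc t ℕ.* m)     ≡⟨ cong (_*_ (a ^ t)) (ℤ.^-*-assoc a (suc t) m) ⟨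
  a ^ t * (a ^ suc t) ^ m       ≈⟨ *-cong-mod (≡-mod-refl {a = a ^ t}) (^-cong-mod m (fermat-unit pp p∤a)) ⟩
  a ^ t * 1ℤ ^ m                ≡⟨ cong (_*_ (a ^ t)) (ℤ.^-zeroˡ m) ⟩
  a ^ t * 1ℤ                    ≡⟨ ℤ.*-identityʳ (a ^ t) ⟩
  a ^ t                         ∎
  where open ≡-mod-Reasoning (+ p)

-- Euler's totient of a prime power

-- φ N is  count (λ k → gcd k N ℕ.≟ 1) N  by definition.
module _ {P : Pred ℕ 0ℓ} (P? : Decidable P) where

  count : ℕ → ℕ
  count n = length (filter P? (map suc (upTo n)))

  count-suc : ∀ n → count (suc n) ≡ count n ℕ.+ length (filter P? (suc n ∷ []))
  count-suc n = begin
    length (filter P? (map suc (upTo (suc n))))         ≡⟨ cong (length ∘ filter P? ∘ map suc) (List.upTo-∷ʳ n) ⟨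
    length (filter P? (map suc (upTo n ++ n ∷ [])))      ≡⟨ cong (length ∘ filter P?) (List.map-++ suc (upTo n) (n ∷ [])) ⟩
    length (filter P? (map suc (upTo n) ++ suc n ∷ []))  ≡⟨ cong length (List.filter-++ P? (map suc (upTo n)) (suc n ∷ [])) ⟩
    length (filter P? (map suc (upTo n)) ++ filter P? (suc n ∷ []))
                                                         ≡⟨ List.length-++ (filter P? (map suc (upTo n))) ⟩
    count n ℕ.+ length (filter P? (suc n ∷ []))          ∎
    where open ≡-Reasoning

  count-accept : ∀ {n} → P (suc n) → count (suc n) ≡ suc (count n)
  count-accept {n} Pn = trans (count-suc n)
    (trans (cong (λ l → count n ℕ.+ length l) (List.filter-accept P? Pn)) (ℕ.+-comm (count n) 1))

  count-reject : ∀ {n} → ¬ P (suc n) → count (suc n) ≡ count n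
  count-reject {n} ¬Pn = trans (count-suc n)
    (trans (cong (λ l → count n ℕ.+ length l) (List.filter-reject P? ¬Pn)) (ℕ.+-identityʳ (count n)))

module _ {p} (pp : Prime p) where

  p∤⇒gcd[k,p^m]≡1 : ∀ {k} → ¬ p ℕD.∣ k → ∀ m → gcd k (p ℕ.^ m) ≡ 1
  p∤⇒gcd[k,p^m]≡1 {k} p∤k m = Coprime.coprime⇒gcd≡1 (coprime-^ m)
    where
    coprime-^ : ∀ m → Coprime k (p ℕ.^ m)
    coprime-^ zero    (_ , d∣1)         = ℕD.∣1⇒≡1 d∣1
    coprime-^ (suc m) (d∣k , d∣p*p^m) = coprime-^ m (d∣k , Coprime.coprime-divisor d⊥p d∣p*p^m)
      where d⊥p = Coprime.sym (prime∤⇒coprime pp (λ p∣d → p∤k (ℕD.∣-trans p∣d d∣k)))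

  p∣⇒gcd[k,p^[1+m]]≢1 : ∀ {k} → p ℕD.∣ k → ∀ m → gcd k (p ℕ.^ suc m) ≢ 1
  p∣⇒gcd[k,p^[1+m]]≢1 p∣k m gcd≡1 =
    ¬prime[1] (subst Prime (ℕD.∣1⇒≡1 (subst (p ℕD.∣_) gcd≡1 (gcd-greatest p∣k (ℕD.m∣m*n (p ℕ.^ m))))) pp)

private
  module PrimePowerCount {p-1} (pp : Prime (suc p-1)) (m : ℕ) where

    p = suc p-1

    coprime? = λ k → gcd k (p ℕ.^ suc m) ℕ.≟ 1

    count-interior : ∀ q j → j ℕ.< p → count coprime? (q ℕ.* p ℕ.+ j) ≡ count coprime? (q ℕ.* p) ℕ.+ j
    count-interior q zero    _   = trans (cong (count coprime?) (ℕ.+-identityʳ (q ℕ.* p))) (sym (ℕ.+-identityʳ _))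
    count-interior q (suc j) j<p = begin
      count coprime? (q ℕ.* p ℕ.+ suc j)    ≡⟨ cong (count coprime?) (ℕ.+-suc (q ℕ.* p) j) ⟩
      count coprime? (suc (q ℕ.* p ℕ.+ j))  ≡⟨ count-accept coprime? (p∤⇒gcd[k,p^m]≡1 pp p∤ (suc m)) ⟩
      suc (count coprime? (q ℕ.* p ℕ.+ j))  ≡⟨ cong suc (count-interior q j (ℕ.<-trans (ℕ.n<1+n j) j<p)) ⟩
      suc (count coprime? (q ℕ.* p) ℕ.+ j)  ≡⟨ ℕ.+-suc _ j ⟨
      count coprime? (q ℕ.* p) ℕ.+ suc j    ∎
      where
      open ≡-Reasoning
      p∤ : ¬ p ℕD.∣ suc (q ℕ.* p ℕ.+ j)
      p∤ p∣ = ℕ.<⇒≱ j<p (ℕD.∣⇒≤ (ℕD.∣m+n∣m⇒∣n (subst (p ℕD.∣_) (sym (ℕ.+-suc (q ℕ.* p) j)) p∣) (ℕD.n∣m*n q)))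

    count-multiple : ∀ q → count coprime? (q ℕ.* p) ≡ q ℕ.* p-1
    count-multiple zero    = refl
    count-multiple (suc q) = begin
      count coprime? (p ℕ.+ q ℕ.* p)           ≡⟨ cong (count coprime?) p+qp≡1+[qp+p-1] ⟩
      count coprime? (suc (q ℕ.* p ℕ.+ p-1))   ≡⟨ count-reject coprime? (p∣⇒gcd[k,p^[1+m]]≢1 pp p∣ m) ⟩
      count coprime? (q ℕ.* p ℕ.+ p-1)         ≡⟨ count-interior q p-1 (ℕ.n<1+n p-1) ⟩
      count coprime? (q ℕ.* p) ℕ.+ p-1         ≡⟨ cong (ℕ._+ p-1) (count-multiple q) ⟩
      q ℕ.* p-1 ℕ.+ p-1                        ≡⟨ ℕ.+-comm (q ℕ.* p-1) p-1 ⟩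
      suc q ℕ.* p-1                            ∎
      where
      open ≡-Reasoning
      p+qp≡1+[qp+p-1] : p ℕ.+ q ℕ.* p ≡ suc (q ℕ.* p ℕ.+ p-1)
      p+qp≡1+[qp+p-1] = trans (ℕ.+-comm p (q ℕ.* p)) (ℕ.+-suc (q ℕ.* p) p-1)
      p∣ : p ℕD.∣ suc (q ℕ.* p ℕ.+ p-1)
      p∣ = subst (p ℕD.∣_) p+qp≡1+[qp+p-1] (ℕD.n∣m*n (suc q))

φ-prime-power : ∀ {p} → Prime p → ∀ m → φ (p ℕ.^ suc m) ≡ p ℕ.^ m ℕ.* (p ∸ 1)
φ-prime-power {suc p-1} pp m = trans (cong (count coprime?) (ℕ.*-comm p (p ℕ.^ m))) (count-multiple (p ℕ.^ m))
  where open PrimePowerCount pp m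

-- Euler quotients

pos-^ : ∀ m n → + (m ℕ.^ n) ≡ (+ m) ^ n
pos-^ m zero    = refl
pos-^ m (suc n) = trans (ℤ.pos-* m (m ℕ.^ n)) (cong (_*_ (+ m)) (pos-^ m n))

p∣p^[1+s] : ∀ p s → + p ∣ + (p ℕ.^ suc s)
p∣p^[1+s] p s = subst (+ p ∣_) (sym (ℤ.pos-* p (p ℕ.^ s))) (∣m⇒∣m*n _ ∣-refl)

+[n∸1]≡-1 : ∀ n .{{_ : NonZero n}} → + (n ∸ 1) ≡ - 1ℤ [mod + n ]
+[n∸1]≡-1 (suc n) = ≡-mod (divides 1ℤ (trans (cong +_ (ℕ.+-comm n 1)) (sym (ℤ.*-identityˡ (+ suc n)))))

-- Prime 0 and Prime 1 are empty, so this single clause is exhaustive.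
pred-prime≢0 : ∀ {p} → Prime p → NonZero (p ∸ 1)
pred-prime≢0 {suc (suc _)} _ = _

[[v+xd]^N-1]/ℕd : ∀ d .{{_ : NonZero d}} N .{{_ : NonZero N}} v x →
  ((v + x * + d) ^ N - 1ℤ) /ℕ d ≡ (v ^ N - 1ℤ) /ℕ d + + N * x * v ^ (N ∸ 1) [mod + d ]
[[v+xd]^N-1]/ℕd d (suc n) v x = /ℕ-cong-mod {b = v ^ suc n - 1ℤ} {y = + suc n * x * v ^ n} (begin
  (v + x * + d) ^ suc n - 1ℤ                  ≈⟨ +-cong-mod (≡-mod-weaken d*d∣xd*xd (first-order-binomial v (x * + d) n))
                                                              (≡-mod-refl {a = - 1ℤ}) ⟩
  v ^ suc n + + suc n * (x * + d) * v ^ n - 1ℤ ≡⟨ identity (v ^ suc n) (v ^ n) (+ suc n) x (+ d) ⟩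
  (v ^ suc n - 1ℤ) + + suc n * x * v ^ n * + d ∎)
  where
  open ≡-mod-Reasoning (+ d * + d)
  square : ∀ x d → (x * d) * (x * d) ≡ x * x * (d * d)
  square = solve-∀
  d*d∣xd*xd : + d * + d ∣ (x * + d) * (x * + d)
  d*d∣xd*xd = divides (x * x) (square x (+ d))
  identity : ∀ A B N x d → A + N * (x * d) * B - 1ℤ ≡ (A - 1ℤ) + N * x * B * d
  identity = solve-∀

module _ {p} (pp : Prime p) where

  private
    instance
      p≢0 : NonZero p
      p≢0 = prime⇒nonZero pp

  Q-multiple : ∀ r {u} → + p ∣ u → Q p pp r u ≡ 0
  Q-multiple r {u} p∣u with + p ∣? u
  ... | yes _  = refl
  ... | no p∤u = ⊥-elim (p∤u p∣u)

  Q-unit : ∀ r {u} → ¬ + p ∣ u → let instance _ = ℕ.m^n≢0 p r in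
           Q p pp r u ≡ ((u ^ φ (p ℕ.^ r) - 1ℤ) /ℕ p ℕ.^ r) %ℕ p ℕ.^ r
  Q-unit r {u} p∤u with + p ∣? u
  ... | yes p∣u = ⊥-elim (p∤u p∣u)
  ... | no _    = refl

  Q<p^r : ∀ r u → Q p pp r u ℕ.< p ℕ.^ r
  Q<p^r r u with + p ∣? u
  ... | yes _ = ℕ.>-nonZero⁻¹ (p ℕ.^ r) {{ℕ.m^n≢0 p r}}
  ... | no _  = n%ℕd<d ((u ^ φ (p ℕ.^ r) - 1ℤ) /ℕ p ℕ.^ r) (p ℕ.^ r)
    where instance _ = ℕ.m^n≢0 p r

  H-multiple : ∀ s {u} → + p ∣ u → H p pp s u ≡ 0
  H-multiple zero    p∣u = Q-multiple 1 p∣u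
  H-multiple (suc s) p∣u rewrite Q-multiple (suc (suc s)) p∣u | Q-multiple (suc s) p∣u =
    trans (cong (ℕ._% p) (0/n≡0 (p ℕ.^ suc s) {{ℕ.m^n≢0 p (suc s)}})) (m<n⇒m%n≡m (ℕ.>-nonZero⁻¹ p))

  p∤v+xp^[1+s] : ∀ s {v} x → ¬ + p ∣ v → ¬ + p ∣ v + x * + (p ℕ.^ suc s)
  p∤v+xp^[1+s] s x p∤v p∣u = p∤v (∣m+n∣n⇒∣m p∣u (∣n⇒∣m*n x (p∣p^[1+s] p s)))

  +φ[p^[2+s]] : ∀ s → + φ (p ℕ.^ suc (suc s)) ≡ + (p ∸ 1) * + (p ℕ.^ suc s)
  +φ[p^[2+s]] s = trans (cong +_ (trans (φ-prime-power pp (suc s)) (ℕ.*-comm (p ℕ.^ suc s) (p ∸ 1))))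
                        (ℤ.pos-* (p ∸ 1) (p ℕ.^ suc s))

  +φ[p^[1+s]]*p : ∀ s → + φ (p ℕ.^ suc s) * + p ≡ + (p ∸ 1) * + (p ℕ.^ suc s)
  +φ[p^[1+s]]*p s = begin
    + φ (p ℕ.^ suc s) * + p            ≡⟨ ℤ.pos-* (φ (p ℕ.^ suc s)) p ⟨
    + (φ (p ℕ.^ suc s) ℕ.* p)          ≡⟨ cong (λ n → + (n ℕ.* p)) (φ-prime-power pp s) ⟩
    + (p ℕ.^ s ℕ.* (p ∸ 1) ℕ.* p)      ≡⟨ cong +_ (identity (p ℕ.^ s) (p ∸ 1) p) ⟩
    + ((p ∸ 1) ℕ.* p ℕ.^ suc s)        ≡⟨ ℤ.pos-* (p ∸ 1) (p ℕ.^ suc s) ⟩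
    + (p ∸ 1) * + (p ℕ.^ suc s)        ∎
    where
    open ≡-Reasoning
    identity : ∀ a b p → a ℕ.* b ℕ.* p ≡ b ℕ.* (p ℕ.* a)
    identity = ℕ-solve-∀

  Q-shift : ∀ s {v} x → ¬ + p ∣ v →
            + Q p pp (suc s) (v + x * + (p ℕ.^ suc s))
              ≡ + Q p pp (suc s) v + + φ (p ℕ.^ suc s) * x * v ^ (φ (p ℕ.^ suc s) ∸ 1) [mod + (p ℕ.^ suc s) ]
  Q-shift s {v} x p∤v = begin
    + Q p pp (suc s) u                      ≡⟨ cong +_ (Q-unit (suc s) (p∤v+xp^[1+s] s x p∤v)) ⟩
    + (F u %ℕ d)                            ≈⟨ %ℕ-mod (F u) ⟩
    F u                                     ≈⟨ [[v+xd]^N-1]/ℕd d N v x ⟩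
    F v + NxW                               ≈⟨ +-cong-mod (≡-mod-sym (%ℕ-mod (F v))) (≡-mod-refl {a = NxW}) ⟩
    + (F v %ℕ d) + NxW                      ≡⟨ cong (λ q → + q + NxW) (Q-unit (suc s) p∤v) ⟨
    + Q p pp (suc s) v + NxW                ∎
    where
    d = p ℕ.^ suc s
    N = φ d
    u = v + x * + d
    NxW = + N * x * v ^ (N ∸ 1)
    instance
      d≢0 : NonZero d
      d≢0 = ℕ.m^n≢0 p (suc s)
      N≢0 : NonZero N
      N≢0 = subst NonZero (sym (φ-prime-power pp s))
                  (ℕ.m*n≢0 (p ℕ.^ s) (p ∸ 1) {{ℕ.m^n≢0 p s}} {{pred-prime≢0 pp}})
    F : ℤ → ℤ
    F w = (w ^ N - 1ℤ) /ℕ d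
    open ≡-mod-Reasoning (+ d)

  Q-stable : ∀ s {v} k → ¬ + p ∣ v → Q p pp (suc s) (v + k * + (p ℕ.^ suc (suc s))) ≡ Q p pp (suc s) v
  Q-stable s {v} k p∤v = residue-unique {{ℕ.m^n≢0 p (suc s)}} (Q<p^r (suc s) _) (Q<p^r (suc s) v) (begin
    + Q p pp (suc s) (v + k * + (p ℕ.* d))  ≡⟨ cong (λ w → + Q p pp (suc s) (v + w)) k*[p*d]≡k*p*d ⟩
    + Q p pp (suc s) (v + k * + p * + d)    ≈⟨ Q-shift s (k * + p) p∤v ⟩
    Qv + + φ d * (k * + p) * W              ≡⟨ cong (_+_ Qv) (identity₁ (+ φ d) k (+ p) W) ⟩
    Qv + + φ d * + p * (k * W)              ≡⟨ cong (λ z → Qv + z * (k * W)) (+φ[p^[1+s]]*p s) ⟩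
    Qv + + (p ∸ 1) * + d * (k * W)          ≡⟨ cong (_+_ Qv) (identity₂ (+ (p ∸ 1)) (+ d) k W) ⟩
    Qv + + (p ∸ 1) * (k * W) * + d          ≈⟨ +-multiple-mod Qv (+ (p ∸ 1) * (k * W)) ⟩
    Qv                                      ∎)
    where
    d = p ℕ.^ suc s
    W = v ^ (φ d ∸ 1)
    Qv = + Q p pp (suc s) v
    open ≡-mod-Reasoning (+ d)
    k*[p*d]≡k*p*d : k * + (p ℕ.* d) ≡ k * + p * + d
    k*[p*d]≡k*p*d = trans (cong (_*_ k) (ℤ.pos-* p d)) (sym (ℤ.*-assoc k (+ p) (+ d)))
    identity₁ : ∀ n k p W → n * (k * p) * W ≡ n * p * (k * W)
    identity₁ = solve-∀
    identity₂ : ∀ a d k W → a * d * (k * W) ≡ a * (k * W) * d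
    identity₂ = solve-∀

  Q-difference-shift : ∀ s {v} k → ¬ + p ∣ v →
    let D = p ℕ.^ suc s
        u = v + k * + (p ℕ.* D)
        W = v ^ (φ (p ℕ.* D) ∸ 1)
    in  + Q p pp (suc (suc s)) u - + Q p pp (suc s) u
          ≡ (+ Q p pp (suc (suc s)) v - + Q p pp (suc s) v) + + (p ∸ 1) * k * W * + D [mod + D * + p ]
  Q-difference-shift s {v} k p∤v = begin
    + Q p pp (suc (suc s)) u - + Q p pp (suc s) u  ≡⟨ cong (λ q → + Q p pp (suc (suc s)) u - + q) (Q-stable s k p∤v) ⟩
    + Q p pp (suc (suc s)) u - Q₁v                 ≈⟨ +-cong-mod (≡-mod-weaken D*p∣p*D (Q-shift (suc s) k p∤v))
                                                                 (≡-mod-refl {a = - Q₁v}) ⟩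
    Q₂v + + φ (p ℕ.* D) * k * W - Q₁v              ≡⟨ cong (λ n → Q₂v + n * k * W - Q₁v) (+φ[p^[2+s]] s) ⟩
    Q₂v + + (p ∸ 1) * + D * k * W - Q₁v            ≡⟨ identity Q₂v Q₁v (+ (p ∸ 1)) (+ D) k W ⟩
    (Q₂v - Q₁v) + + (p ∸ 1) * k * W * + D          ∎
    where
    D = p ℕ.^ suc s
    u = v + k * + (p ℕ.* D)
    W = v ^ (φ (p ℕ.* D) ∸ 1)
    Q₁v = + Q p pp (suc s) v
    Q₂v = + Q p pp (suc (suc s)) v
    open ≡-mod-Reasoning (+ D * + p)
    D*p∣p*D : + D * + p ∣ + (p ℕ.* D)
    D*p∣p*D = ∣-reflexive (trans (sym (ℤ.pos-* D p)) (cong +_ (ℕ.*-comm D p)))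
    identity : ∀ a b c d k W → a + c * d * k * W - b ≡ (a - b) + c * k * W * d
    identity = solve-∀

  H-shift : ∀ s {v} k → ¬ + p ∣ v →
            + H p pp s (v + k * + (p ℕ.^ suc s)) ≡ + H p pp s v + + (p ∸ 1) * k * v ^ (φ (p ℕ.^ suc s) ∸ 1) [mod + p ]
  H-shift zero {v} k p∤v = begin
    + Q p pp 1 (v + k * + (p ℕ.^ 1))      ≈⟨ ≡-mod-weaken (p∣p^[1+s] p 0) (Q-shift 0 k p∤v) ⟩
    + Q p pp 1 v + + φ (p ℕ.^ 1) * k * W  ≡⟨ cong (λ n → + Q p pp 1 v + + n * k * W) φ[p^1]≡p∸1 ⟩
    + Q p pp 1 v + + (p ∸ 1) * k * W      ∎
    where
    W = v ^ (φ (p ℕ.^ 1) ∸ 1)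
    φ[p^1]≡p∸1 = trans (φ-prime-power pp 0) (ℕ.*-identityˡ (p ∸ 1))
    open ≡-mod-Reasoning (+ p)
  H-shift (suc s) {v} k p∤v = begin
    + ((X u /ℕ D) %ℕ p)                       ≈⟨ %ℕ-mod (X u /ℕ D) ⟩
    X u /ℕ D                                  ≈⟨ /ℕ-cong-mod {b = X v} {y = p-1kW} (Q-difference-shift s k p∤v) ⟩
    X v /ℕ D + p-1kW                          ≈⟨ +-cong-mod (≡-mod-sym (%ℕ-mod (X v /ℕ D))) (≡-mod-refl {a = p-1kW}) ⟩
    + ((X v /ℕ D) %ℕ p) + p-1kW               ∎
    where
    D = p ℕ.^ suc s
    instance D≢0 = ℕ.m^n≢0 p (suc s)
    u = v + k * + (p ℕ.* D)
    p-1kW = + (p ∸ 1) * k * v ^ (φ (p ℕ.* D) ∸ 1)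
    X : ℤ → ℤ
    X w = + Q p pp (suc (suc s)) w - + Q p pp (suc s) w
    open ≡-mod-Reasoning (+ p)

  H-congruence : ∀ s {v} k → ¬ + p ∣ v →
                 + H p pp s (v + k * + (p ℕ.^ suc s)) ≡ + H p pp s v - k * v ^ (p ∸ 2) [mod + p ]
  H-congruence s {v} k p∤v = begin
    + H p pp s (v + k * + (p ℕ.^ suc s))                ≈⟨ H-shift s k p∤v ⟩
    Hv + + (p ∸ 1) * k * v ^ (φ (p ℕ.^ suc s) ∸ 1)      ≡⟨ cong (λ e → Hv + + (p ∸ 1) * k * v ^ (e ∸ 1)) (φ-prime-power pp s) ⟩
    Hv + + (p ∸ 1) * k * v ^ (p ℕ.^ s ℕ.* (p ∸ 1) ∸ 1) ≈⟨ +-cong-mod (≡-mod-refl {a = Hv})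
                                                            (*-cong-mod (*-cong-mod (+[n∸1]≡-1 p) (≡-mod-refl {a = k}))
                                                                        (^[m*[p∸1]∸1]≡^[p∸2] pp p∤v (p ℕ.^ s) {{ℕ.m^n≢0 p s}})) ⟩
    Hv + - 1ℤ * k * v ^ (p ∸ 2)                          ≡⟨ cong (_+_ Hv) (identity k (v ^ (p ∸ 2))) ⟩
    Hv - k * v ^ (p ∸ 2)                                 ∎
    where
    Hv = + H p pp s v
    open ≡-mod-Reasoning (+ p)
    identity : ∀ k V → - 1ℤ * k * V ≡ - (k * V)
    identity = solve-∀

theorem1 : (p : ℕ) (pp : Prime p) → ¬ (2 ℕD.∣ p) →
    (v k : ℤ) (r : ℕ) → 1 ℕ.≤ r →
    (+ p) ∣ ((+ H p pp (r ℕ.∸ 1) (v + k * (+ p) ^ r))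
             - ((+ H p pp (r ℕ.∸ 1) v) - k * v ^ (p ℕ.∸ 2)))
theorem1 2 _ 2∤2 _ _ _ _ = ⊥-elim (2∤2 ℕD.∣-refl)
theorem1 p@(suc (suc (suc t))) pp _ v k (suc s) _ rewrite sym (pos-^ p (suc s)) with + p ∣? v
... | no p∤v  = ∣-difference (H-congruence pp s k p∤v)
... | yes p∣v rewrite H-multiple pp s (∣m∣n⇒∣m+n p∣v (∣n⇒∣m*n k (p∣p^[1+s] p s))) | H-multiple pp s p∣v =
  subst (+ p ∣_) (identity k (v ^ suc t)) (∣n⇒∣m*n k (∣m⇒∣m*n (v ^ t) p∣v))
  where
  identity : ∀ k V → k * V ≡ 0ℤ - (0ℤ - k * V)
  identity = solve-∀
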